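{- Let $n\ge 4$ and let $\Sigma_n$ be the loopless Schreier graph of the Basilica group on level $n$. The number of cycles labeled $a$ in $\Sigma_n$ (i.e. orbits of size $\ge2$ of $a$ on $\{0,1\}^n$) is - $\frac{2^{n-1}+2}{3}$ if $n$ is odd; - $\frac{2^{n-1}+1}{3}$ if $n$ is even. The number of cycles labeled $b$ is - $\frac{2^n+1}{3}$ if $n$ is odd; - $\frac{2^n+2}{3}$ if $n$ is even. The total number of cycles of length $\ge 2$ is $2^{n-1}+1$, and the total number of edges of $\Sigma_n$ is $3\cdot 2^{n-1}$.
   Context: The Basilica group is generated by the maps $a,b$ on binary words defined recursively for any binary word $w$ by - $a(0w)=0\,b(w)$ and $a(1w)=1w$; - $b(0w)=1\,a(w)$ and $b(1w)=0w$. The loopless Schreier graph $\Sigma_n$ has vertex set $\{0,1\}^n$. For each $s\in\{a,b\}$ and each $u$ with $s(u)\ne u$, it has one edge labeled $s$ joining $u$ to $s(u)$. An orbit of $s$ of size $j\ge 2$ is called a cycle of length $j$ labeled $s$; in particular, an orbit of size $2$ gives two parallel edges. -}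

module Defs where

open import Data.Bool using (Bool; true; false)
open import Data.Nat using (ℕ; zero; suc; _+_; _*_; _^_; _≤_; _<_; _≤?_)
open import Data.Nat.Properties using (allUpTo?)
open import Data.Vec using (Vec; []; _∷_)
open import Data.List using (List; []; _∷_; map; _++_; length; filter)
open import Data.Product using (_×_)
open import Relation.Nullary using (¬_; Dec)
open import Relation.Nullary.Decidable using (_×-dec_; ¬?)
open import Relation.Binary.PropositionalEquality using (_≡_)
open import Data.Vec.Properties using (≡-dec)
open import Data.Bool.Properties using () renaming (_≟_ to _≟ᵇ_)

-- Binary words of length n: letter 0 = false, letter 1 = true.
Word : ℕ → Set
Word n = Vec Bool n

basA : ∀ {n} → Word n → Word n
basB : ∀ {n} → Word n → Word n
basA []          = []
basA (false ∷ w) = false ∷ basB w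
basA (true  ∷ w) = true ∷ w
basB []          = []
basB (false ∷ w) = true ∷ basA w
basB (true  ∷ w) = false ∷ w

allWords : (n : ℕ) → List (Word n)
allWords zero    = [] ∷ []
allWords (suc n) = map (false ∷_) (allWords n) ++ map (true ∷_) (allWords n)

iter : ∀ {A : Set} → (A → A) → ℕ → A → A
iter f zero    x = x
iter f (suc k) x = f (iter f k x)

-- Numerical value of a word (binary, first letter most significant);
-- an injective map to ℕ, used to pick a canonical representative of each orbit.
val : ∀ {n} → Word n → ℕ
val []              = 0
val {suc n} (false ∷ w) = val w
val {suc n} (true  ∷ w) = 2 ^ n + val w

-- u is the minimum (w.r.t. val) of its s-orbit {s^k u | k < 2^n};
-- since an orbit in {0,1}^n has at most 2^n elements, this is the whole orbit.
IsOrbitMin : ∀ {n} → (Word n → Word n) → Word n → Set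
IsOrbitMin {n} s u = ∀ {k} → k < 2 ^ n → val u ≤ val (iter s k u)

-- u represents a cycle labelled s (an s-orbit of size ≥ 2):
-- u is moved by s and is the minimum of its orbit.
IsCycleRep : ∀ {n} → (Word n → Word n) → Word n → Set
IsCycleRep s u = (¬ (s u ≡ u)) × IsOrbitMin s u

isCycleRep? : ∀ {n} (s : Word n → Word n) (u : Word n) → Dec (IsCycleRep s u)
isCycleRep? {n} s u =
  ¬? (≡-dec _≟ᵇ_ (s u) u) ×-dec allUpTo? (λ k → val u ≤? val (iter s k u)) (2 ^ n)

numCycles : (n : ℕ) → (∀ {m} → Word m → Word m) → ℕ
numCycles n s = length (filter (isCycleRep? s) (allWords n))

-- Number of edges labelled s: one edge u — s(u) for each u with s(u) ≠ u.
numEdges : (n : ℕ) → (∀ {m} → Word m → Word m) → ℕ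
numEdges n s = length (filter (λ u → ¬? (≡-dec _≟ᵇ_ (s u) u)) (allWords n))

cyclesA cyclesB totalCycles totalEdges : ℕ → ℕ
cyclesA n = numCycles n basA
cyclesB n = numCycles n basB
totalCycles n = cyclesA n + cyclesB n
totalEdges n = numEdges n basA + numEdges n basB

-- Reading off the first letter: a fixes every word 1w and acts on 0w as b on w, while b never
-- fixes a nonempty word, has b² acting on 0w and on 1w as a on w, and has 1w sharing an orbit
-- with the smaller word 0w. So the b-orbits on level n+1 are in bijection with the a-orbits on
-- level n, and the a-orbits on level n+1 with the b-orbits on level n plus 2^n fixed points.
-- Hence the number β_n of b-orbits satisfies β_(n+2) = β_n + 2^n, giving 3β_n = 2^n + 2 or
-- 2^n + 1 by parity, and the a- and b-orbits on level n number 2^n + 1 together. The cycles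
-- are these orbits minus the fixed points: all b-orbits on nonempty levels, and the a-cycles
-- on level n+1 correspond to the b-cycles on level n.
module Submission where

open import Defs
open import Data.Bool using (true; false) renaming (_≟_ to _≟ᵇ_)
open import Data.Nat using (ℕ; zero; suc; _+_; _*_; _^_; _∸_; _≤_; _<_; _≤?_; _/_; _%_; z≤n; s≤s; NonZero)
open import Data.Nat.Properties
open import Data.Nat.DivMod using (m≡m%n+[m/n]*n; m%n<n; m*n/n≡m)
open import Data.Nat.Tactic.RingSolver using (solve-∀)
open import Data.Vec using ([]; _∷_)
open import Data.Vec.Properties using (∷-injectiveʳ; ≡-dec)
open import Data.List using (List; []; _∷_; map; _++_; length; filter)
open import Data.List.Properties using (length-++; length-map; filter-++; filter-≐; filter-all; filter-none)
open import Data.List.Relation.Unary.All using (universal)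
open import Data.Product using (_×_; _,_; proj₁; proj₂; ∃-syntax)
open import Data.Sum using (_⊎_; inj₁; inj₂)
open import Function using (_∘_)
open import Relation.Nullary using (does; ¬?)
open import Relation.Unary using (Pred; Decidable; Universal; Empty; _≐_)
open import Relation.Binary.PropositionalEquality
  using (_≡_; _≢_; refl; sym; trans; cong; cong₂; subst; module ≡-Reasoning)

count : ∀ {A : Set} {ℓ} {P : Pred A ℓ} → Decidable P → List A → ℕ
count P? xs = length (filter P? xs)

module _ {A : Set} {ℓ} {P : Pred A ℓ} (P? : Decidable P) where

  count-++ : ∀ xs ys → count P? (xs ++ ys) ≡ count P? xs + count P? ys
  count-++ xs ys = trans (cong length (filter-++ P? xs ys)) (length-++ (filter P? xs))

  count-universal : Universal P → ∀ xs → count P? xs ≡ length xs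
  count-universal all xs = cong length (filter-all P? (universal all xs))

  count-empty : Empty P → ∀ xs → count P? xs ≡ 0
  count-empty none xs = cong length (filter-none P? (universal none xs))

  count-map : ∀ {B : Set} (f : B → A) xs → count P? (map f xs) ≡ count (P? ∘ f) xs
  count-map f []       = refl
  count-map f (x ∷ xs) with does (P? (f x))
  ... | true  = cong suc (count-map f xs)
  ... | false = count-map f xs

count-≐ : ∀ {A : Set} {p q} {P : Pred A p} {Q : Pred A q} (P? : Decidable P) (Q? : Decidable Q) →
          P ≐ Q → ∀ xs → count P? xs ≡ count Q? xs
count-≐ P? Q? P≐Q xs = cong length (filter-≐ P? Q? P≐Q xs)

length-allWords : ∀ n → length (allWords n) ≡ 2 ^ n
length-allWords zero    = refl
length-allWords (suc n) = begin
  length (map (false ∷_) (allWords n) ++ map (true ∷_) (allWords n))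
    ≡⟨ length-++ (map (false ∷_) (allWords n)) ⟩
  length (map (false ∷_) (allWords n)) + length (map (true ∷_) (allWords n))
    ≡⟨ cong₂ _+_ (length-map (false ∷_) (allWords n)) (length-map (true ∷_) (allWords n)) ⟩
  length (allWords n) + length (allWords n)
    ≡⟨ cong₂ _+_ (length-allWords n) (length-allWords n) ⟩
  2 ^ n + 2 ^ n
    ≡⟨ cong (2 ^ n +_) (sym (+-identityʳ (2 ^ n))) ⟩
  2 ^ suc n ∎
  where open ≡-Reasoning

count-allWords-suc : ∀ n {ℓ} {P : Pred (Word (suc n)) ℓ} (P? : Decidable P) →
  count P? (allWords (suc n)) ≡ count (P? ∘ (false ∷_)) (allWords n) + count (P? ∘ (true ∷_)) (allWords n)
count-allWords-suc n P? = trans (count-++ P? (map (false ∷_) (allWords n)) _)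
  (cong₂ _+_ (count-map P? (false ∷_) (allWords n)) (count-map P? (true ∷_) (allWords n)))

iter-+ : ∀ {A : Set} (f : A → A) m k x → iter f (m + k) x ≡ iter f m (iter f k x)
iter-+ f zero    k x = refl
iter-+ f (suc m) k x = cong f (iter-+ f m k x)

module _ {A : Set} {f : A → A} {p : ℕ} (period : ∀ x → iter f p x ≡ x) where

  iter-*-period : ∀ q x → iter f (q * p) x ≡ x
  iter-*-period zero    x = refl
  iter-*-period (suc q) x = trans (iter-+ f p (q * p) x) (trans (cong (iter f p) (iter-*-period q x)) (period x))

  iter-%-period : .{{_ : NonZero p}} → ∀ k x → iter f k x ≡ iter f (k % p) x
  iter-%-period k x = begin
    iter f k x                              ≡⟨ cong (λ j → iter f j x) (m≡m%n+[m/n]*n k p) ⟩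
    iter f (k % p + (k / p) * p) x          ≡⟨ iter-+ f (k % p) _ x ⟩
    iter f (k % p) (iter f ((k / p) * p) x) ≡⟨ cong (iter f (k % p)) (iter-*-period (k / p) x) ⟩
    iter f (k % p) x                        ∎
    where open ≡-Reasoning

iter-basA-false : ∀ {n} k (w : Word n) → iter basA k (false ∷ w) ≡ false ∷ iter basB k w
iter-basA-false zero    w = refl
iter-basA-false (suc k) w = cong basA (iter-basA-false k w)

iter-basA-true : ∀ {n} k (w : Word n) → iter basA k (true ∷ w) ≡ true ∷ w
iter-basA-true zero    w = refl
iter-basA-true (suc k) w = cong basA (iter-basA-true k w)

basB²-∷ : ∀ {n} x (w : Word n) → basB (basB (x ∷ w)) ≡ x ∷ basA w
basB²-∷ false w = refl
basB²-∷ true  w = refl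

iter-basB-double : ∀ {n} k x (w : Word n) → iter basB (k + k) (x ∷ w) ≡ x ∷ iter basA k w
iter-basB-double zero    x w = refl
iter-basB-double (suc k) x w = begin
  iter basB (suc k + suc k) (x ∷ w)             ≡⟨ cong (λ j → iter basB (suc j) (x ∷ w)) (+-suc k k) ⟩
  basB (basB (iter basB (k + k) (x ∷ w)))       ≡⟨ cong (basB ∘ basB) (iter-basB-double k x w) ⟩
  basB (basB (x ∷ iter basA k w))               ≡⟨ basB²-∷ x (iter basA k w) ⟩
  x ∷ iter basA (suc k) w                       ∎
  where open ≡-Reasoning

iter-basB-false : ∀ {n} k (w : Word n) →
  ∃[ j ] (iter basB k (false ∷ w) ≡ false ∷ iter basA j w ⊎ iter basB k (false ∷ w) ≡ true ∷ iter basA j w)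
iter-basB-false zero w = 0 , inj₁ refl
iter-basB-false (suc k) w with iter-basB-false k w
... | j , inj₁ e = suc j , inj₂ (cong basB e)
... | j , inj₂ e = j , inj₁ (cong basB e)

basA-period : ∀ n (w : Word n) → iter basA (2 ^ n) w ≡ w
basB-period : ∀ n (w : Word n) → iter basB (2 ^ n) w ≡ w

basA-period zero    []          = refl
basA-period (suc n) (false ∷ w) =
  trans (iter-basA-false (2 * 2 ^ n) w) (cong (false ∷_) (iter-*-period {f = basB} {p = 2 ^ n} (basB-period n) 2 w))
basA-period (suc n) (true ∷ w) = iter-basA-true (2 ^ suc n) w

basB-period zero    []      = refl
basB-period (suc n) (x ∷ w) = begin
  iter basB (2 ^ n + (2 ^ n + 0)) (x ∷ w)   ≡⟨ cong (λ j → iter basB (2 ^ n + j) (x ∷ w)) (+-identityʳ (2 ^ n)) ⟩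
  iter basB (2 ^ n + 2 ^ n) (x ∷ w)         ≡⟨ iter-basB-double (2 ^ n) x w ⟩
  x ∷ iter basA (2 ^ n) w                   ≡⟨ cong (x ∷_) (basA-period n w) ⟩
  x ∷ w                                     ∎
  where open ≡-Reasoning

val<2^n : ∀ {n} (w : Word n) → val w < 2 ^ n
val<2^n []                = s≤s z≤n
val<2^n {suc n} (false ∷ w) = ≤-trans (val<2^n w) (m≤m+n (2 ^ n) _)
val<2^n {suc n} (true  ∷ w) = +-monoʳ-< (2 ^ n) (≤-trans (val<2^n w) (≤-reflexive (sym (+-identityʳ (2 ^ n)))))

OrbitMinimal : ∀ {n} → (Word n → Word n) → Word n → Set
OrbitMinimal s u = ∀ k → val u ≤ val (iter s k u)

orbitMinimal⇒isOrbitMin : ∀ {n} {s : Word n → Word n} {u} → OrbitMinimal s u → IsOrbitMin s u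
orbitMinimal⇒isOrbitMin m {k} _ = m k

isOrbitMin⇒orbitMinimal : ∀ {n} {s : Word n → Word n} → (∀ x → iter s (2 ^ n) x ≡ x) →
                          ∀ {u} → IsOrbitMin s u → OrbitMinimal s u
isOrbitMin⇒orbitMinimal {n} {s} period {u} m k =
  subst (λ v → val u ≤ val v) (sym (iter-%-period period k u)) (m (m%n<n k (2 ^ n)))
  where instance _ = m^n≢0 2 n

orbitMinimal-basA : ∀ {n} {u : Word n} → IsOrbitMin basA u → OrbitMinimal basA u
orbitMinimal-basA {n} = isOrbitMin⇒orbitMinimal (basA-period n)

orbitMinimal-basB : ∀ {n} {u : Word n} → IsOrbitMin basB u → OrbitMinimal basB u
orbitMinimal-basB {n} = isOrbitMin⇒orbitMinimal (basB-period n)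

isOrbitMin-basA-false : ∀ {n} → IsOrbitMin basA ∘ (false ∷_) ≐ IsOrbitMin {n} basB
isOrbitMin-basA-false =
  (λ {w} m → orbitMinimal⇒isOrbitMin λ k →
     subst (λ v → val w ≤ val v) (iter-basA-false k w) (orbitMinimal-basA m k)) ,
  (λ {w} m → orbitMinimal⇒isOrbitMin λ k →
     subst (λ v → val w ≤ val v) (sym (iter-basA-false k w)) (orbitMinimal-basB m k))

isOrbitMin-basA-true : ∀ {n} → Universal (IsOrbitMin {suc n} basA ∘ (true ∷_))
isOrbitMin-basA-true w = orbitMinimal⇒isOrbitMin λ k → ≤-reflexive (cong val (sym (iter-basA-true k w)))

-- The odd iterates of b on 0w begin with the letter 1, so they exceed 0w.
orbitMinimal-basB-false : ∀ {n} {w : Word n} → OrbitMinimal basA w → OrbitMinimal basB (false ∷ w)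
orbitMinimal-basB-false {n} {w} m k with iter-basB-false k w
... | j , inj₁ e = subst (λ v → val w ≤ val v) (sym e) (m j)
... | j , inj₂ e = subst (λ v → val w ≤ val v) (sym e) (≤-trans (<⇒≤ (val<2^n w)) (m≤m+n (2 ^ n) _))

isOrbitMin-basB-false : ∀ {n} → IsOrbitMin basB ∘ (false ∷_) ≐ IsOrbitMin {n} basA
isOrbitMin-basB-false =
  (λ {w} m → orbitMinimal⇒isOrbitMin λ k →
     subst (λ v → val w ≤ val v) (iter-basB-double k false w) (orbitMinimal-basB m (k + k))) ,
  (λ m → orbitMinimal⇒isOrbitMin (orbitMinimal-basB-false (orbitMinimal-basA m)))

¬isOrbitMin-basB-true : ∀ {n} → Empty (IsOrbitMin {suc n} basB ∘ (true ∷_))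
¬isOrbitMin-basB-true {n} w m = <⇒≱ (m<n+m (val w) (m^n>0 2 n)) (orbitMinimal-basB m 1)

Moves : ∀ {n} → (Word n → Word n) → Word n → Set
Moves s u = s u ≢ u

moves? : ∀ {n} (s : Word n → Word n) → Decidable (Moves s)
moves? s u = ¬? (≡-dec _≟ᵇ_ (s u) u)

moves-basA-false : ∀ {n} → Moves basA ∘ (false ∷_) ≐ Moves {n} basB
moves-basA-false = (λ mv → mv ∘ cong (false ∷_)) , (λ mv → mv ∘ ∷-injectiveʳ)

¬moves-basA-true : ∀ {n} → Empty (Moves {suc n} basA ∘ (true ∷_))
¬moves-basA-true w mv = mv refl

moves-basB : ∀ {n} → Universal (Moves {suc n} basB)
moves-basB (false ∷ w) ()
moves-basB (true  ∷ w) ()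

isCycleRep-basA-false : ∀ {n} → IsCycleRep basA ∘ (false ∷_) ≐ IsCycleRep {n} basB
isCycleRep-basA-false =
  (λ (mv , m) → proj₁ moves-basA-false mv , proj₁ isOrbitMin-basA-false m) ,
  (λ (mv , m) → proj₂ moves-basA-false mv , proj₂ isOrbitMin-basA-false m)

¬isCycleRep-basA-true : ∀ {n} → Empty (IsCycleRep {suc n} basA ∘ (true ∷_))
¬isCycleRep-basA-true w (mv , _) = ¬moves-basA-true w mv

isCycleRep-basB≐isOrbitMin : ∀ {n} → IsCycleRep {suc n} basB ≐ IsOrbitMin basB
isCycleRep-basB≐isOrbitMin = proj₂ , λ {u} m → moves-basB u , m

isOrbitMin? : ∀ {n} (s : Word n → Word n) → Decidable (IsOrbitMin s)
isOrbitMin? {n} s u = allUpTo? (λ k → val u ≤? val (iter s k u)) (2 ^ n)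

numOrbits : ℕ → (∀ {m} → Word m → Word m) → ℕ
numOrbits n s = count (isOrbitMin? s) (allWords n)

numOrbits-basA-suc : ∀ n → numOrbits (suc n) basA ≡ numOrbits n basB + 2 ^ n
numOrbits-basA-suc n = trans (count-allWords-suc n (isOrbitMin? basA)) (cong₂ _+_
  (count-≐ _ (isOrbitMin? basB) isOrbitMin-basA-false (allWords n))
  (trans (count-universal _ isOrbitMin-basA-true (allWords n)) (length-allWords n)))

numOrbits-basB-suc : ∀ n → numOrbits (suc n) basB ≡ numOrbits n basA
numOrbits-basB-suc n = trans (count-allWords-suc n (isOrbitMin? basB)) (trans (cong₂ _+_
  (count-≐ _ (isOrbitMin? basA) isOrbitMin-basB-false (allWords n))
  (count-empty _ ¬isOrbitMin-basB-true (allWords n))) (+-identityʳ _))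

cyclesA-suc : ∀ n → cyclesA (suc n) ≡ cyclesB n
cyclesA-suc n = trans (count-allWords-suc n (isCycleRep? basA)) (trans (cong₂ _+_
  (count-≐ _ (isCycleRep? basB) isCycleRep-basA-false (allWords n))
  (count-empty _ ¬isCycleRep-basA-true (allWords n))) (+-identityʳ _))

cyclesB-suc : ∀ n → cyclesB (suc n) ≡ numOrbits (suc n) basB
cyclesB-suc n = count-≐ (isCycleRep? basB) (isOrbitMin? basB) isCycleRep-basB≐isOrbitMin (allWords (suc n))

numEdges-basA-suc : ∀ n → numEdges (suc n) basA ≡ numEdges n basB
numEdges-basA-suc n = trans (count-allWords-suc n (moves? basA)) (trans (cong₂ _+_
  (count-≐ _ (moves? basB) moves-basA-false (allWords n))
  (count-empty _ ¬moves-basA-true (allWords n))) (+-identityʳ _))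

numEdges-basB-suc : ∀ n → numEdges (suc n) basB ≡ 2 ^ suc n
numEdges-basB-suc n = trans (count-universal (moves? basB) moves-basB (allWords (suc n))) (length-allWords (suc n))

numOrbits-sum : ∀ n → numOrbits n basA + numOrbits n basB ≡ 2 ^ n + 1
numOrbits-sum zero    = refl
numOrbits-sum (suc n) = begin
  numOrbits (suc n) basA + numOrbits (suc n) basB
    ≡⟨ cong₂ _+_ (numOrbits-basA-suc n) (numOrbits-basB-suc n) ⟩
  (numOrbits n basB + 2 ^ n) + numOrbits n basA
    ≡⟨ regroup (2 ^ n) (numOrbits n basA) (numOrbits n basB) ⟩
  2 ^ n + (numOrbits n basA + numOrbits n basB)
    ≡⟨ cong (2 ^ n +_) (numOrbits-sum n) ⟩
  2 ^ n + (2 ^ n + 1)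
    ≡⟨ double (2 ^ n) ⟩
  2 ^ suc n + 1 ∎
  where
  open ≡-Reasoning
  regroup : ∀ p a b → (b + p) + a ≡ p + (a + b)
  regroup = solve-∀
  double : ∀ p → p + (p + 1) ≡ 2 * p + 1
  double = solve-∀

numOrbits-basB-suc-suc : ∀ n → numOrbits (suc (suc n)) basB ≡ numOrbits n basB + 2 ^ n
numOrbits-basB-suc-suc n = trans (numOrbits-basB-suc (suc n)) (numOrbits-basA-suc n)

numOrbits-basB-closed : ∀ n → 3 * numOrbits n basB + n % 2 ≡ 2 ^ n + 2
numOrbits-basB-closed zero          = refl
numOrbits-basB-closed (suc zero)    = refl
numOrbits-basB-closed (suc (suc n)) = begin
  3 * numOrbits (suc (suc n)) basB + n % 2
    ≡⟨ cong (λ b → 3 * b + n % 2) (numOrbits-basB-suc-suc n) ⟩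
  3 * (numOrbits n basB + 2 ^ n) + n % 2
    ≡⟨ regroup (2 ^ n) (numOrbits n basB) (n % 2) ⟩
  (3 * numOrbits n basB + n % 2) + 3 * 2 ^ n
    ≡⟨ cong (_+ 3 * 2 ^ n) (numOrbits-basB-closed n) ⟩
  (2 ^ n + 2) + 3 * 2 ^ n
    ≡⟨ quadruple (2 ^ n) ⟩
  2 ^ suc (suc n) + 2 ∎
  where
  open ≡-Reasoning
  regroup : ∀ p b r → 3 * (b + p) + r ≡ (3 * b + r) + 3 * p
  regroup = solve-∀
  quadruple : ∀ p → (p + 2) + 3 * p ≡ 2 * (2 * p) + 2
  quadruple = solve-∀

≡/3 : ∀ x y → 3 * x ≡ y → x ≡ y / 3
≡/3 x y refl = sym (trans (cong (_/ 3) (*-comm 3 x)) (m*n/n≡m x 3))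

numOrbits-basB-odd : ∀ n → n % 2 ≡ 1 → numOrbits n basB ≡ (2 ^ n + 1) / 3
numOrbits-basB-odd n odd = ≡/3 _ _ (+-cancelʳ-≡ 1 _ _
  (trans (cong (3 * numOrbits n basB +_) (sym odd))
         (trans (numOrbits-basB-closed n) (sym (+-assoc (2 ^ n) 1 1)))))

numOrbits-basB-even : ∀ n → n % 2 ≡ 0 → numOrbits n basB ≡ (2 ^ n + 2) / 3
numOrbits-basB-even n even = ≡/3 _ _
  (trans (sym (+-identityʳ _)) (trans (cong (3 * numOrbits n basB +_) (sym even)) (numOrbits-basB-closed n)))

suc-%2 : ∀ n → suc n % 2 ≡ 1 ∸ n % 2
suc-%2 zero          = refl
suc-%2 (suc zero)    = refl
suc-%2 (suc (suc n)) = suc-%2 n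

corollary2p5 : (n : ℕ) → 4 ≤ n →
      (n % 2 ≡ 1 → cyclesA n ≡ (2 ^ (n ∸ 1) + 2) / 3 × cyclesB n ≡ (2 ^ n + 1) / 3)
    × (n % 2 ≡ 0 → cyclesA n ≡ (2 ^ (n ∸ 1) + 1) / 3 × cyclesB n ≡ (2 ^ n + 2) / 3)
    × totalCycles n ≡ 2 ^ (n ∸ 1) + 1
    × totalEdges n ≡ 3 * 2 ^ (n ∸ 1)
corollary2p5 n@(suc (suc m)) (s≤s (s≤s _)) = odd , even , total , edges
  where
  cyclesA≡ : cyclesA n ≡ numOrbits (suc m) basB
  cyclesA≡ = trans (cyclesA-suc (suc m)) (cyclesB-suc m)
  cyclesB≡ : cyclesB n ≡ numOrbits n basB
  cyclesB≡ = cyclesB-suc (suc m)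
  odd : n % 2 ≡ 1 → cyclesA n ≡ (2 ^ suc m + 2) / 3 × cyclesB n ≡ (2 ^ n + 1) / 3
  odd h = trans cyclesA≡ (numOrbits-basB-even (suc m) (trans (suc-%2 m) (cong (1 ∸_) h))) ,
          trans cyclesB≡ (numOrbits-basB-odd n h)
  even : n % 2 ≡ 0 → cyclesA n ≡ (2 ^ suc m + 1) / 3 × cyclesB n ≡ (2 ^ n + 2) / 3
  even h = trans cyclesA≡ (numOrbits-basB-odd (suc m) (trans (suc-%2 m) (cong (1 ∸_) h))) ,
           trans cyclesB≡ (numOrbits-basB-even n h)
  total : totalCycles n ≡ 2 ^ suc m + 1
  total = trans (cong₂ _+_ cyclesA≡ (trans cyclesB≡ (numOrbits-basB-suc (suc m))))
                (trans (+-comm (numOrbits (suc m) basB) _) (numOrbits-sum (suc m)))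
  edges : totalEdges n ≡ 3 * 2 ^ suc m
  edges = cong₂ _+_ (trans (numEdges-basA-suc (suc m)) (numEdges-basB-suc m)) (numEdges-basB-suc (suc m))
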